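{- Let $C_n$ be the cycle graph on $n\ge 3$ vertices. Then $$A(C_n;x)=n\,x^{n-2}+n(n-2)\,x^n+x^{n+2}.$$
   Context: For a finite simple graph $\Gamma=(V,E)$ of order $n$, a vertex $v$ and $X\subseteq V$, $\delta_X(v)$ is the number of neighbours of $v$ in $X$, $\delta_1$ the maximum degree, $\bar S=V\setminus S$, and $\mathcal{K}=[-\delta_1,\delta_1]\cap\mathbb{Z}$. A nonempty $S\subseteq V$ is a defensive $k$-alliance if $\delta_S(v)\ge\delta_{\bar S}(v)+k$ for all $v\in S$; its exact index of alliance is $k_S=\max\{k\in\mathcal{K}: S \text{ is a defensive } k\text{ -alliance}\}$. The alliance polynomial is $A(\Gamma;x)=\sum_{S} x^{n+k_S}$, the sum over all nonempty $S\subseteq V$ with induced subgraph $\langle S\rangle$ connected. -}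

module Defs where

open import Data.Bool using (Bool; true; false; _∧_; _∨_; not; if_then_else_; T)
open import Data.Nat as ℕ using (ℕ; zero; suc; _%_; _∸_; _⊔_)
open import Data.Nat.Properties using (_≟_)
open import Data.Integer as ℤ using (ℤ; +_; -_; _≤?_)
import Data.Integer.Properties as ℤP
open import Data.Fin using (Fin; toℕ)
open import Data.Fin.Subset using (Subset; ∁)
open import Data.Fin.Subset.Properties using (_∈?_)
open import Data.Vec using (Vec; []; _∷_)
open import Data.List as List using (List; []; _∷_; filter; allFin; upTo; length; map)
open import Data.Vec.Functional using (Vector)
open import Relation.Nullary.Decidable using (⌊_⌋)
open import Data.Fin.Properties using (any?; all?)

record Graph : Set where
  field
    order : ℕ
    adj   : Fin order → Fin order → Bool

open Graph public

allSubsets : (n : ℕ) → List (Subset n)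
allSubsets zero    = [] ∷ []
allSubsets (suc n) = List.concatMap (λ s → (false ∷ s) ∷ (true ∷ s) ∷ []) (allSubsets n)

countB : {A : Set} → (A → Bool) → List A → ℕ
countB p xs = length (filter (λ x → Relation.Nullary.Decidable.Core.T? (p x)) xs)
  where import Relation.Nullary.Decidable.Core

inB : ∀ {n} → Fin n → Subset n → Bool
inB v S = ⌊ v ∈? S ⌋

δ : (Γ : Graph) → Subset (order Γ) → Fin (order Γ) → ℕ
δ Γ X v = countB (λ u → adj Γ v u ∧ inB u X) (allFin (order Γ))

deg : (Γ : Graph) → Fin (order Γ) → ℕ
deg Γ v = countB (λ u → adj Γ v u) (allFin (order Γ))

δ₁ : Graph → ℕ
δ₁ Γ = List.foldr _⊔_ 0 (map (deg Γ) (allFin (order Γ)))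

isDefAlliance : (Γ : Graph) → Subset (order Γ) → ℤ → Bool
isDefAlliance Γ S k =
  ⌊ all? (λ v → Relation.Nullary.Decidable.Core.T? (not (inB v S) ∨
        ⌊ (+ δ Γ (∁ S) v) ℤ.+ k ≤? + δ Γ S v ⌋)) ⌋
  where import Relation.Nullary.Decidable.Core

𝒦 : Graph → List ℤ
𝒦 Γ = map (λ i → (- (+ δ₁ Γ)) ℤ.+ (+ i)) (upTo (suc (2 ℕ.* δ₁ Γ)))

maxℤ : ℤ → List ℤ → ℤ
maxℤ d []       = d
maxℤ d (x ∷ xs) = List.foldr ℤ._⊔_ x xs

-- exact index of alliance k_S = max { k ∈ 𝒦 : S is a defensive k-alliance }
-- (the set is always nonempty since k = -δ₁ works, so the default is never used)
kS : (Γ : Graph) → Subset (order Γ) → ℤ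
kS Γ S = maxℤ (- (+ δ₁ Γ))
  (filter (λ k → Relation.Nullary.Decidable.Core.T? (isDefAlliance Γ S k)) (𝒦 Γ))
  where import Relation.Nullary.Decidable.Core

-- walk of length ≤ t from u to v staying inside S (u, v assumed in S)
walkWithin : (Γ : Graph) → Subset (order Γ) → ℕ → Fin (order Γ) → Fin (order Γ) → Bool
walkWithin Γ S zero    u v = ⌊ toℕ u ≟ toℕ v ⌋
walkWithin Γ S (suc t) u v =
  ⌊ toℕ u ≟ toℕ v ⌋ ∨
  ⌊ any? (λ w → Relation.Nullary.Decidable.Core.T?
       (adj Γ u w ∧ inB w S ∧ walkWithin Γ S t w v)) ⌋
  where import Relation.Nullary.Decidable.Core

-- the induced subgraph ⟨S⟩ is connected: any two vertices of S are joined by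
-- a walk inside S (a walk of length ≤ n suffices in a graph of order n)
connectedB : (Γ : Graph) → Subset (order Γ) → Bool
connectedB Γ S =
  ⌊ all? (λ u → Relation.Nullary.Decidable.Core.T? (⌊ all? (λ v →
      Relation.Nullary.Decidable.Core.T?
        (not (inB u S ∧ inB v S) ∨ walkWithin Γ S (order Γ) u v)) ⌋)) ⌋
  where import Relation.Nullary.Decidable.Core

nonemptyB : ∀ {n} → Subset n → Bool
nonemptyB S = ⌊ any? (λ v → Relation.Nullary.Decidable.Core.T? (inB v S)) ⌋
  where import Relation.Nullary.Decidable.Core

-- Polynomials with natural coefficients, as coefficient functions: p m = coefficient of x^m
Poly : Set
Poly = ℕ → ℕ

mono : ℕ → ℕ → Poly
mono c e m = if ⌊ m ≟ e ⌋ then c else 0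

_+ₚ_ : Poly → Poly → Poly
(p +ₚ q) m = p m ℕ.+ q m
infixl 6 _+ₚ_

-- alliance polynomial A(Γ;x) = Σ_{S ≠ ∅, ⟨S⟩ connected} x^{n + k_S}:
-- coefficient of x^m is the number of such S with n + k_S = m
alliancePoly : Graph → Poly
alliancePoly Γ m = countB
  (λ S → nonemptyB S ∧ connectedB Γ S ∧
         ⌊ (+ order Γ) ℤ.+ kS Γ S ℤ.≟ + m ⌋)
  (allSubsets (order Γ))

-- cycle graph C_n on Fin n: i ~ j iff j = i+1, or i = j+1, or {i,j} = {0, n-1}
-- (i.e. j ≡ i ± 1 mod n)
cycleAdjℕ : ℕ → ℕ → ℕ → Bool
cycleAdjℕ n i j = ⌊ suc i ≟ j ⌋ ∨ ⌊ suc j ≟ i ⌋ ∨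
                  (⌊ i ≟ 0 ⌋ ∧ ⌊ suc j ≟ n ⌋) ∨ (⌊ j ≟ 0 ⌋ ∧ ⌊ suc i ≟ n ⌋)

cycleGraph : (n : ℕ) → Graph
cycleGraph n = record { order = n ; adj = λ i j → cycleAdjℕ n (toℕ i) (toℕ j) }

module Submission where

-- Identify a subset S of the vertex set {0,…,n-1} with its bit vector, and call
-- i a (cyclic) right end of S when i ∈ S but its cyclic successor is not.
--  * Connectivity: ⟨S⟩ is connected iff S has at most one right end (one
--    direction builds walks along the cycle, the other shows that a walk cannot
--    leave the arc between two right ends).
--  * Alliance index: C_n is 2-regular, so δ₁ = 2 and k_S is read off from the
--    least value of δ_S on S: a singleton has k_S = -2, a proper arc with at
--    least two vertices has k_S = 0, and the whole cycle has k_S = 2.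
--  * Counting: a 12-state automaton reading the bit vector recognises the shape
--    of S (empty, singleton, arc, whole cycle, disconnected); counting the words
--    accepted in each class by a transfer-function recursion gives n singletons,
--    n(n-2) arcs and one whole cycle.
-- Combining these, the term counted by alliancePoly for S at exponent e equals
-- the verdict of the automaton's final state on S with answers [e = n-2] for
-- singletons, [e = n] for arcs and [e = n+2] for the whole cycle, and the
-- theorem is the count of those verdicts.

open import Defs
open import Data.Nat using (ℕ; _≤_; _∸_; _+_; _*_)
open import Relation.Binary.PropositionalEquality using (_≡_)

open import Algebra.Properties.CommutativeSemigroup using (interchange)
open import Data.Bool using (Bool; true; false; _∧_; _∨_; not; if_then_else_; T; T?)
open import Data.Bool.Properties using (T-∧; T-∨; ∧-zeroʳ; ∧-identityʳ)
open import Data.Empty using (⊥; ⊥-elim)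
open import Data.Fin as F using (Fin; toℕ; fromℕ<)
open import Data.Fin.Properties using (toℕ-fromℕ<; toℕ<n; toℕ-injective; all?)
open import Data.Fin.Subset using (Subset; ∁)
open import Data.Integer as ℤ using (ℤ; -[1+_])
import Data.Integer.Properties as ℤP
open import Data.List as List using (List; []; _∷_)
open import Data.Nat as ℕ using (zero; suc; _<_; z≤n; s≤s; s≤s⁻¹; _≡ᵇ_; _⊔_)
open import Data.Nat.Properties
open import Data.Nat.Tactic.RingSolver using (solve-∀)
open import Data.Product using (Σ; _×_; _,_; proj₁; proj₂)
open import Data.Sum using (_⊎_; inj₁; inj₂)
open import Data.Unit using (tt)
open import Data.Vec using (Vec; []; _∷_; _∷ʳ_)
open import Function.Bundles using (module Equivalence)
open import Relation.Binary using (tri<; tri≈; tri>)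
open import Relation.Binary.PropositionalEquality
  using (refl; sym; trans; cong; cong₂; subst; subst₂; _≢_; module ≡-Reasoning)
open import Relation.Nullary using (¬_; yes; no)
open import Relation.Nullary.Decidable
  using (⌊_⌋; toWitness; fromWitness; isYes≗does; dec-true; dec-false)

open Equivalence using (to; from)

[_]ᵇ : Bool → ℕ
[ true ]ᵇ  = 1
[ false ]ᵇ = 0

T-ext : ∀ {x y : Bool} → (T x → T y) → (T y → T x) → x ≡ y
T-ext {true}  {true}  _ _ = refl
T-ext {true}  {false} f _ = ⊥-elim (f tt)
T-ext {false} {true}  _ g = ⊥-elim (g tt)
T-ext {false} {false} _ _ = refl

T-true : ∀ {b} → b ≡ true → T b
T-true refl = tt

true-T : ∀ {b} → T b → b ≡ true
true-T {true} _ = refl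

false-¬T : ∀ {b} → ¬ T b → b ≡ false
false-¬T {false} _ = refl
false-¬T {true}  f = ⊥-elim (f tt)

not-¬T : ∀ {b} → ¬ T b → T (not b)
not-¬T {false} _ = tt
not-¬T {true}  f = f tt

T-not : ∀ {b} → T (not b) → ¬ T b
T-not {false} _ ()

≟-T : ∀ {x y} → x ≡ y → T ⌊ x ≟ y ⌋
≟-T = fromWitness

T-≟ : ∀ {x y} → T ⌊ x ≟ y ⌋ → x ≡ y
T-≟ = toWitness

count : ℕ → (ℕ → Bool) → ℕ
count zero    q = 0
count (suc n) q = [ q 0 ]ᵇ + count n (λ j → q (suc j))

count-ext : ∀ n {q q' : ℕ → Bool} → (∀ j → j < n → q j ≡ q' j) → count n q ≡ count n q'
count-ext zero    e = refl
count-ext (suc n) e =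
  cong₂ _+_ (cong [_]ᵇ (e 0 (s≤s z≤n))) (count-ext n (λ j j<n → e (suc j) (s≤s j<n)))

count-snoc : ∀ n (q : ℕ → Bool) → count (suc n) q ≡ count n q + [ q n ]ᵇ
count-snoc zero    q = +-comm [ q 0 ]ᵇ 0
count-snoc (suc n) q =
  trans (cong ([ q 0 ]ᵇ +_) (count-snoc n (λ j → q (suc j)))) (sym (+-assoc [ q 0 ]ᵇ _ _))

count-≤ : ∀ n (q : ℕ → Bool) → count n q ≤ n
count-≤ zero    q = z≤n
count-≤ (suc n) q with q 0
... | true  = s≤s (count-≤ n _)
... | false = m≤n⇒m≤1+n (count-≤ n _)

count-< : ∀ n (q : ℕ → Bool) j → j < n → ¬ T (q j) → count n q < n
count-< (suc n) q zero    _ f with q 0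
... | false = s≤s (count-≤ n _)
... | true  = ⊥-elim (f tt)
count-< (suc n) q (suc j) (s≤s j<n) f with q 0
... | true  = s≤s (count-< n _ j j<n f)
... | false = m≤n⇒m≤1+n (count-< n _ j j<n f)

count-zero : ∀ n (q : ℕ → Bool) → (∀ j → j < n → ¬ T (q j)) → count n q ≡ 0
count-zero zero    q h = refl
count-zero (suc n) q h with q 0 in eq
... | true  = ⊥-elim (h 0 (s≤s z≤n) (T-true eq))
... | false = count-zero n _ (λ j j<n → h (suc j) (s≤s j<n))

count-≥1 : ∀ n (q : ℕ → Bool) j → j < n → T (q j) → 1 ≤ count n q
count-≥1 (suc n) q zero    _ t with q 0
... | true = s≤s z≤n
count-≥1 (suc n) q (suc j) (s≤s j<n) t = ≤-trans (count-≥1 n _ j j<n t) (m≤n+m _ [ q 0 ]ᵇ)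

count-≥2 : ∀ n (q : ℕ → Bool) i j → i < j → j < n → T (q i) → T (q j) → 2 ≤ count n q
count-≥2 (suc n) q zero    (suc j) _ (s≤s j<n) ti tj with q 0
... | true = s≤s (count-≥1 n _ j j<n tj)
count-≥2 (suc n) q (suc i) (suc j) (s≤s i<j) (s≤s j<n) ti tj =
  ≤-trans (count-≥2 n _ i j i<j j<n ti tj) (m≤n+m _ [ q 0 ]ᵇ)

count-≥1-witness : ∀ n (q : ℕ → Bool) → 1 ≤ count n q → Σ ℕ λ j → j < n × T (q j)
count-≥1-witness (suc n) q h with q 0 in eq
... | true  = 0 , s≤s z≤n , T-true eq
... | false with count-≥1-witness n _ h
...   | j , j<n , t = suc j , s≤s j<n , t

count-≥2-witness : ∀ n (q : ℕ → Bool) → 2 ≤ count n q →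
  Σ ℕ λ i → Σ ℕ λ j → i < j × j < n × T (q i) × T (q j)
count-≥2-witness (suc n) q h with q 0 in eq
... | true with count-≥1-witness n _ (s≤s⁻¹ h)
...   | j , j<n , t = 0 , suc j , s≤s z≤n , s≤s j<n , T-true eq , t
count-≥2-witness (suc n) q h | false with count-≥2-witness n _ h
...   | i , j , i<j , j<n , ti , tj = suc i , suc j , s≤s i<j , s≤s j<n , ti , tj

count-split : ∀ n (q p : ℕ → Bool) →
  count n q ≡ count n (λ j → q j ∧ p j) + count n (λ j → q j ∧ not (p j))
count-split zero    q p = refl
count-split (suc n) q p with q 0 | p 0
... | true  | true  = cong suc (count-split n _ _)
... | true  | false = trans (cong suc (count-split n _ _)) (sym (+-suc _ _))
... | false | _     = count-split n _ _

count-∨ : ∀ n (q p : ℕ → Bool) → (∀ j → T (q j) → T (p j) → ⊥) →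
  count n (λ j → q j ∨ p j) ≡ count n q + count n p
count-∨ zero    q p d = refl
count-∨ (suc n) q p d with q 0 in e₁ | p 0 in e₂
... | true  | true  = ⊥-elim (d 0 (T-true e₁) (T-true e₂))
... | true  | false = cong suc (count-∨ n _ _ (λ j → d (suc j)))
... | false | true  = trans (cong suc (count-∨ n _ _ (λ j → d (suc j)))) (sym (+-suc _ _))
... | false | false = count-∨ n _ _ (λ j → d (suc j))

count-point : ∀ n a → a < n → count n (λ j → ⌊ j ≟ a ⌋) ≡ 1
count-point (suc n) zero    _         = cong suc (count-zero n _ (λ _ _ ()))
count-point (suc n) (suc a) (s≤s a<n) =
  trans (count-ext n (λ j _ → T-ext (λ t → ≟-T (suc-injective (T-≟ t)))
                                    (λ t → ≟-T (cong suc (T-≟ t)))))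
        (count-point n a a<n)

countB-∷ : ∀ {A : Set} (p : A → Bool) x xs → countB p (x ∷ xs) ≡ [ p x ]ᵇ + countB p xs
countB-∷ p x xs with p x
... | true  = refl
... | false = refl

countB-ext : ∀ {A : Set} {p p' : A → Bool} xs → (∀ x → p x ≡ p' x) → countB p xs ≡ countB p' xs
countB-ext []                  e = refl
countB-ext {p = p} {p'} (x ∷ xs) e =
  trans (countB-∷ p x xs)
        (trans (cong₂ _+_ (cong [_]ᵇ (e x)) (countB-ext xs e)) (sym (countB-∷ p' x xs)))

countB-tabulate : ∀ n {B : Set} (f : Fin n → B) (p : B → Bool) (q : ℕ → Bool) →
  (∀ i → p (f i) ≡ q (toℕ i)) → countB p (List.tabulate f) ≡ count n q
countB-tabulate zero    f p q e = refl
countB-tabulate (suc n) f p q e =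
  trans (countB-∷ p (f F.zero) _)
        (cong₂ _+_ (cong [_]ᵇ (e F.zero))
                   (countB-tabulate n (λ i → f (F.suc i)) p (λ j → q (suc j)) (λ i → e (F.suc i))))

#subsets : ∀ k → (Vec Bool k → Bool) → ℕ
#subsets k p = countB p (allSubsets k)

countB-pairs : ∀ {A B : Set} (p : B → Bool) (a b : A → B) xs →
  countB p (List.concatMap (λ s → a s ∷ b s ∷ []) xs)
    ≡ countB (λ x → p (a x)) xs + countB (λ x → p (b x)) xs
countB-pairs p a b []       = refl
countB-pairs p a b (x ∷ xs) =
  begin
    countB p (a x ∷ b x ∷ rest)
  ≡⟨ countB-∷ p (a x) _ ⟩
    [ p (a x) ]ᵇ + countB p (b x ∷ rest)
  ≡⟨ cong ([ p (a x) ]ᵇ +_) (countB-∷ p (b x) _) ⟩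
    [ p (a x) ]ᵇ + ([ p (b x) ]ᵇ + countB p rest)
  ≡⟨ cong (λ z → [ p (a x) ]ᵇ + ([ p (b x) ]ᵇ + z)) (countB-pairs p a b xs) ⟩
    [ p (a x) ]ᵇ + ([ p (b x) ]ᵇ + (countB pa xs + countB pb xs))
  ≡⟨ shuffle [ p (a x) ]ᵇ [ p (b x) ]ᵇ (countB pa xs) (countB pb xs) ⟩
    ([ p (a x) ]ᵇ + countB pa xs) + ([ p (b x) ]ᵇ + countB pb xs)
  ≡⟨ sym (cong₂ _+_ (countB-∷ pa x xs) (countB-∷ pb x xs)) ⟩
    countB pa (x ∷ xs) + countB pb (x ∷ xs)
  ∎
  where
  open ≡-Reasoning
  rest = List.concatMap (λ s → a s ∷ b s ∷ []) xs
  pa = λ y → p (a y)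
  pb = λ y → p (b y)
  shuffle : ∀ w x y z → w + (x + (y + z)) ≡ (w + y) + (x + z)
  shuffle = solve-∀

#subsets-∷ : ∀ k p → #subsets (suc k) p ≡ #subsets k (λ S → p (false ∷ S)) + #subsets k (λ S → p (true ∷ S))
#subsets-∷ k p = countB-pairs p (false ∷_) (true ∷_) (allSubsets k)

#subsets-ext : ∀ k {p p'} → (∀ S → p S ≡ p' S) → #subsets k p ≡ #subsets k p'
#subsets-ext k e = countB-ext (allSubsets k) e

-- … or according to the last bit (the automaton below reads vectors from the end).
#subsets-∷ʳ : ∀ k p → #subsets (suc k) p ≡ #subsets k (λ S → p (S ∷ʳ false)) + #subsets k (λ S → p (S ∷ʳ true))
#subsets-∷ʳ zero p =
  trans (#subsets-∷ zero p)
        (cong₂ _+_ (#subsets-ext 0 {λ S → p (false ∷ S)} {λ S → p (S ∷ʳ false)} (λ { [] → refl }))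
                   (#subsets-ext 0 {λ S → p (true ∷ S)} {λ S → p (S ∷ʳ true)} (λ { [] → refl })))
#subsets-∷ʳ (suc k) p =
  begin
    #subsets (suc (suc k)) p
  ≡⟨ #subsets-∷ (suc k) p ⟩
    #subsets (suc k) (λ S → p (false ∷ S)) + #subsets (suc k) (λ S → p (true ∷ S))
  ≡⟨ cong₂ _+_ (#subsets-∷ʳ k _) (#subsets-∷ʳ k _) ⟩
    (ff + ft) + (tf + tt′)
  ≡⟨ interchange +-commutativeSemigroup ff ft tf tt′ ⟩
    (ff + tf) + (ft + tt′)
  ≡⟨ sym (cong₂ _+_ (#subsets-∷ k _) (#subsets-∷ k _)) ⟩
    #subsets (suc k) (λ S → p (S ∷ʳ false)) + #subsets (suc k) (λ S → p (S ∷ʳ true))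
  ∎
  where
  open ≡-Reasoning
  ff = #subsets k (λ S → p (false ∷ (S ∷ʳ false)))
  ft = #subsets k (λ S → p (false ∷ (S ∷ʳ true)))
  tf = #subsets k (λ S → p (true ∷ (S ∷ʳ false)))
  tt′ = #subsets k (λ S → p (true ∷ (S ∷ʳ true)))

-- The shape automaton

-- The automaton reads a bit vector from its last bit to its first.  A state
-- names the block pattern of the bits read so far, listed in vector order:
-- Z is a block of 0s, O a block of 1s, and a trailing 1 records that exactly
-- one bit 1 has been read.  E is the start state; X means that the bits read
-- so far already force at least two cyclic right ends (see Invariant below).
data St : Set where
  E Z O1 O ZO1 ZO OZ1 OZ ZOZ1 ZOZ OZO X : St

every-state : (P : St → Set) →
  P E → P Z → P O1 → P O → P ZO1 → P ZO → P OZ1 → P OZ → P ZOZ1 → P ZOZ → P OZO → P X →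
  ∀ q → P q
every-state P e z o1 o zo1 zo oz1 oz zoz1 zoz ozo x = λ
  { E → e ; Z → z ; O1 → o1 ; O → o ; ZO1 → zo1 ; ZO → zo ; OZ1 → oz1 ; OZ → oz
  ; ZOZ1 → zoz1 ; ZOZ → zoz ; OZO → ozo ; X → x }

read : Bool → St → St
read false E    = Z
read true  E    = O1
read false Z    = Z
read true  Z    = OZ1
read false O1   = ZO1
read true  O1   = O
read false O    = ZO
read true  O    = O
read false ZO1  = ZO1
read true  ZO1  = OZO
read false ZO   = ZO
read true  ZO   = OZO
read false OZ1  = ZOZ1
read true  OZ1  = OZ
read false OZ   = ZOZ
read true  OZ   = OZ
read false ZOZ1 = ZOZ1
read true  ZOZ1 = X
read false ZOZ  = ZOZ
read true  ZOZ  = X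
read false OZO  = X
read true  OZO  = OZO
read _     X    = X

run : ∀ {k} → Vec Bool k → St → St
run []      q = q
run (b ∷ S) q = read b (run S q)

run-∷ʳ : ∀ {k} (S : Vec Bool k) b q → run (S ∷ʳ b) q ≡ run S (read b q)
run-∷ʳ []      b q = refl
run-∷ʳ (c ∷ S) b q = cong (read c) (run-∷ʳ S b q)

count-accepted : (acc : St → Bool) (F : ℕ → St → ℕ) →
  (∀ q → F 0 q ≡ [ acc q ]ᵇ) →
  (∀ k q → F (suc k) q ≡ F k (read false q) + F k (read true q)) →
  ∀ k q → #subsets k (λ S → acc (run S q)) ≡ F k q
count-accepted acc F base rec zero q =
  trans (countB-∷ (λ S → acc (run S q)) [] []) (trans (+-identityʳ _) (sym (base q)))
count-accepted acc F base rec (suc k) q =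
  begin
    #subsets (suc k) (λ S → acc (run S q))
  ≡⟨ #subsets-∷ʳ k _ ⟩
    #subsets k (λ S → acc (run (S ∷ʳ false) q)) + #subsets k (λ S → acc (run (S ∷ʳ true) q))
  ≡⟨ cong₂ _+_ (#subsets-ext k (λ S → cong acc (run-∷ʳ S false q)))
               (#subsets-ext k (λ S → cong acc (run-∷ʳ S true q))) ⟩
    #subsets k (λ S → acc (run S (read false q))) + #subsets k (λ S → acc (run S (read true q)))
  ≡⟨ cong₂ _+_ (count-accepted acc F base rec k (read false q))
               (count-accepted acc F base rec k (read true q)) ⟩
    F k (read false q) + F k (read true q)
  ≡⟨ sym (rec k q) ⟩
    F (suc k) q
  ∎
  where open ≡-Reasoning

-- The verdict of a final state: the answers for a singleton, for a proper arc
-- with at least two vertices, and for the whole cycle; the empty set and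
-- disconnected sets are rejected.
verdict : Bool → Bool → Bool → St → Bool
verdict single arc whole O1   = single
verdict single arc whole ZO1  = single
verdict single arc whole OZ1  = single
verdict single arc whole ZOZ1 = single
verdict single arc whole ZO   = arc
verdict single arc whole OZ   = arc
verdict single arc whole ZOZ  = arc
verdict single arc whole OZO  = arc
verdict single arc whole O    = whole
verdict single arc whole _    = false

-- Transfer function for singletons: from E or Z any of the k remaining bits may
-- be the unique 1; after a 1 has been read only the all-0 completion remains.
singles : ℕ → St → ℕ
singles k E    = k
singles k Z    = k
singles k O1   = 1
singles k ZO1  = 1
singles k OZ1  = 1
singles k ZOZ1 = 1
singles k _    = 0

count-singles : ∀ n → #subsets n (λ S → verdict true false false (run S E)) ≡ n
count-singles n = count-accepted _ singles base rec n E
  where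
  base : ∀ q → singles 0 q ≡ [ verdict true false false q ]ᵇ
  base = every-state _ refl refl refl refl refl refl refl refl refl refl refl refl
  rec : ∀ k q → singles (suc k) q ≡ singles k (read false q) + singles k (read true q)
  rec k = every-state _ (sym (+-comm k 1)) (sym (+-comm k 1))
                        refl refl refl refl refl refl refl refl refl refl

[1≤_] : ℕ → ℕ
[1≤ zero  ] = 0
[1≤ suc _ ] = 1

[2≤_] : ℕ → ℕ
[2≤ zero  ] = 0
[2≤ suc k ] = [1≤ k ]

-- Transfer function for the whole cycle: only the all-1 completion is accepted,
-- and it must contain at least two 1s in total.
wholes : ℕ → St → ℕ
wholes k E  = [2≤ k ]
wholes k O1 = [1≤ k ]
wholes k O  = 1
wholes k _  = 0

count-wholes : ∀ n → #subsets n (λ S → verdict false false true (run S E)) ≡ [2≤ n ]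
count-wholes n = count-accepted _ wholes base rec n E
  where
  base : ∀ q → wholes 0 q ≡ [ verdict false false true q ]ᵇ
  base = every-state _ refl refl refl refl refl refl refl refl refl refl refl refl
  rec : ∀ k q → wholes (suc k) q ≡ wholes k (read false q) + wholes k (read true q)
  rec k = every-state _ refl refl refl refl refl refl refl refl refl refl refl refl

triangle : ℕ → ℕ
triangle zero    = 0
triangle (suc k) = suc k + triangle k

triangle-double : ∀ j → triangle j + triangle j ≡ j * suc j
triangle-double zero    = refl
triangle-double (suc j) =
  trans (regroup j (triangle j))
        (trans (cong (λ z → suc j + suc j + z) (triangle-double j)) (close j))
  where
  regroup : ∀ j t → suc j + t + (suc j + t) ≡ suc j + suc j + (t + t)
  regroup = solve-∀
  close : ∀ j → suc j + suc j + j * suc j ≡ suc j * suc (suc j)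
  close = solve-∀

-- From E this
-- is the closed form k(k-2); the other values count the completions by the
-- position of the remaining block boundaries.
arcs : ℕ → St → ℕ
arcs k E    = k * (k ∸ 2)
arcs k Z    = triangle (k ∸ 1)
arcs k O1   = triangle k ∸ 1
arcs k O    = triangle k
arcs k ZO1  = k
arcs k ZO   = suc k
arcs k OZ1  = k
arcs k OZ   = suc k
arcs k ZOZ1 = 0
arcs k ZOZ  = 1
arcs k OZO  = 1
arcs k X    = 0

arcs-rec-E : ∀ k → suc k * (k ∸ 1) ≡ triangle (k ∸ 1) + (triangle k ∸ 1)
arcs-rec-E zero    = refl
arcs-rec-E (suc j) =
  trans (expand j) (trans (cong (j +_) (sym (triangle-double j))) (regroup j (triangle j)))
  where
  expand : ∀ j → suc (suc j) * j ≡ j + j * suc j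
  expand = solve-∀
  regroup : ∀ j t → j + (t + t) ≡ t + (j + t)
  regroup = solve-∀

arcs-rec-Z : ∀ k → triangle k ≡ triangle (k ∸ 1) + k
arcs-rec-Z zero    = refl
arcs-rec-Z (suc j) = +-comm (suc j) (triangle j)

count-arcs : ∀ n → #subsets n (λ S → verdict false true false (run S E)) ≡ n * (n ∸ 2)
count-arcs n = count-accepted _ arcs base rec n E
  where
  base : ∀ q → arcs 0 q ≡ [ verdict false true false q ]ᵇ
  base = every-state _ refl refl refl refl refl refl refl refl refl refl refl refl
  rec : ∀ k q → arcs (suc k) q ≡ arcs k (read false q) + arcs k (read true q)
  rec k = every-state _ (arcs-rec-E k) (arcs-rec-Z k) refl refl
                        (sym (+-comm k 1)) (sym (+-comm (suc k) 1)) refl refl refl refl refl refl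

count-rejected : ∀ n → #subsets n (λ S → verdict false false false (run S E)) ≡ 0
count-rejected n = count-accepted _ (λ _ _ → 0) base (λ _ _ → refl) n E
  where
  base : ∀ q → 0 ≡ [ verdict false false false q ]ᵇ
  base = every-state _ refl refl refl refl refl refl refl refl refl refl refl refl

-- The automaton invariant

size : ∀ {k} → Vec Bool k → ℕ
size []      = 0
size (b ∷ S) = [ b ]ᵇ + size S

-- First and last bit (with the conventions true, resp. false, for the empty vector).
head : ∀ {k} → Vec Bool k → Bool
head []      = true
head (b ∷ S) = b

last : ∀ {k} → Vec Bool k → Bool
last []          = false
last (b ∷ [])    = b
last (b ∷ c ∷ S) = last (c ∷ S)

linearEnds : ∀ {k} → Vec Bool k → ℕ
linearEnds []      = 0
linearEnds (b ∷ S) = [ b ∧ not (head S) ]ᵇ + linearEnds S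

-- What a state says about a vector of length k with z ones, r linear right
-- ends, first bit h and last bit l.  In X the count r + [l ∧ ¬h] of cyclic
-- right ends is already at least two.
Invariant : St → ℕ → ℕ → ℕ → Bool → Bool → Set
Invariant E    k z r h l = k ≡ 0
Invariant Z    k z r h l = z ≡ 0 × r ≡ 0 × h ≡ false × l ≡ false
Invariant O1   k z r h l = k ≡ 1 × z ≡ 1 × r ≡ 0 × h ≡ true × l ≡ true
Invariant O    k z r h l = z ≡ k × 2 ≤ k × r ≡ 0 × h ≡ true × l ≡ true
Invariant ZO1  k z r h l = z ≡ 1 × 2 ≤ k × r ≡ 0 × h ≡ false × l ≡ true
Invariant ZO   k z r h l = 2 ≤ z × z < k × r ≡ 0 × h ≡ false × l ≡ true
Invariant OZ1  k z r h l = z ≡ 1 × 2 ≤ k × r ≡ 1 × h ≡ true × l ≡ false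
Invariant OZ   k z r h l = 2 ≤ z × z < k × r ≡ 1 × h ≡ true × l ≡ false
Invariant ZOZ1 k z r h l = z ≡ 1 × 2 ≤ k × r ≡ 1 × h ≡ false × l ≡ false
Invariant ZOZ  k z r h l = 2 ≤ z × z < k × r ≡ 1 × h ≡ false × l ≡ false
Invariant OZO  k z r h l = 2 ≤ z × z < k × r ≡ 1 × h ≡ true × l ≡ true
Invariant X    k z r h l = 2 ≤ r + [ l ∧ not h ]ᵇ

private
  2≤2+ : ∀ {k} → 2 ≤ suc (suc k)
  2≤2+ = s≤s (s≤s z≤n)

invariant-read : ∀ q b c k z r l → Invariant q (suc k) z r c l →
  Invariant (read b q) (suc (suc k)) ([ b ]ᵇ + z) ([ b ∧ not c ]ᵇ + r) b l
invariant-read E b c k z r l ()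
invariant-read Z    false .false k .0 .0 .false (refl , refl , refl , refl) = refl , refl , refl , refl
invariant-read Z    true  .false k .0 .0 .false (refl , refl , refl , refl) = refl , 2≤2+ , refl , refl , refl
invariant-read O1   false .true .0 .1 .0 .true (refl , refl , refl , refl , refl) = refl , 2≤2+ , refl , refl , refl
invariant-read O1   true  .true .0 .1 .0 .true (refl , refl , refl , refl , refl) = refl , 2≤2+ , refl , refl , refl
invariant-read O    false .true k .(suc k) .0 .true (refl , k≥2 , refl , refl , refl) = k≥2 , ≤-refl , refl , refl , refl
invariant-read O    true  .true k .(suc k) .0 .true (refl , _ , refl , refl , refl) = refl , 2≤2+ , refl , refl , refl
invariant-read ZO1  false .false k .1 .0 .true (refl , _ , refl , refl , refl) = refl , 2≤2+ , refl , refl , refl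
invariant-read ZO1  true  .false k .1 .0 .true (refl , k≥2 , refl , refl , refl) = 2≤2+ , s≤s k≥2 , refl , refl , refl
invariant-read ZO   false .false k z .0 .true (z≥2 , z<k , refl , refl , refl) = z≥2 , m≤n⇒m≤1+n z<k , refl , refl , refl
invariant-read ZO   true  .false k z .0 .true (z≥2 , z<k , refl , refl , refl) = m≤n⇒m≤1+n z≥2 , s≤s z<k , refl , refl , refl
invariant-read OZ1  false .true k .1 .1 .false (refl , _ , refl , refl , refl) = refl , 2≤2+ , refl , refl , refl
invariant-read OZ1  true  .true k .1 .1 .false (refl , k≥2 , refl , refl , refl) = 2≤2+ , s≤s k≥2 , refl , refl , refl
invariant-read OZ   false .true k z .1 .false (z≥2 , z<k , refl , refl , refl) = z≥2 , m≤n⇒m≤1+n z<k , refl , refl , refl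
invariant-read OZ   true  .true k z .1 .false (z≥2 , z<k , refl , refl , refl) = m≤n⇒m≤1+n z≥2 , s≤s z<k , refl , refl , refl
invariant-read ZOZ1 false .false k .1 .1 .false (refl , _ , refl , refl , refl) = refl , 2≤2+ , refl , refl , refl
invariant-read ZOZ1 true  .false k .1 .1 .false (refl , _ , refl , refl , refl) = 2≤2+
invariant-read ZOZ  false .false k z .1 .false (z≥2 , z<k , refl , refl , refl) = z≥2 , m≤n⇒m≤1+n z<k , refl , refl , refl
invariant-read ZOZ  true  .false k z .1 .false (_ , _ , refl , refl , refl) = 2≤2+
invariant-read OZO  false .true k z .1 .true (_ , _ , refl , refl , refl) = 2≤2+
invariant-read OZO  true  .true k z .1 .true (z≥2 , z<k , refl , refl , refl) = m≤n⇒m≤1+n z≥2 , s≤s z<k , refl , refl , refl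
invariant-read X false false k z r l      h = h
invariant-read X true  true  k z r l      h = h
invariant-read X false true  k z r false  h = h
invariant-read X false true  k z r true   h = ≤-trans h (+-monoʳ-≤ r z≤n)
invariant-read X true  false k z r false  h = ≤-trans h (n≤1+n (r + 0))
invariant-read X true  false k z r true   h = subst (2 ≤_) (trans (+-comm r 1) (cong suc (sym (+-identityʳ r)))) h

invariant : ∀ {k} (S : Vec Bool k) → Invariant (run S E) k (size S) (linearEnds S) (head S) (last S)
invariant []           = refl
invariant (false ∷ []) = refl , refl , refl , refl
invariant (true ∷ [])  = refl , refl , refl , refl , refl
invariant {suc (suc k)} (b ∷ c ∷ S) =
  invariant-read (run (c ∷ S) E) b c k _ _ _ (invariant (c ∷ S))

-- Adjacency in the cycle C_n

Adj : ℕ → ℕ → ℕ → Set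
Adj n i j = T (cycleAdjℕ n i j)

AdjCases : ℕ → ℕ → ℕ → Set
AdjCases n i j = (suc i ≡ j) ⊎ (suc j ≡ i) ⊎ (i ≡ 0 × suc j ≡ n) ⊎ (j ≡ 0 × suc i ≡ n)

adjacent⇒cases : ∀ n i j → Adj n i j → AdjCases n i j
adjacent⇒cases n i j a with to T-∨ a
... | inj₁ e = inj₁ (T-≟ e)
... | inj₂ a′ with to T-∨ a′
...   | inj₁ e = inj₂ (inj₁ (T-≟ e))
...   | inj₂ a″ with to T-∨ a″
...     | inj₁ e = inj₂ (inj₂ (inj₁ (Data.Product.map T-≟ T-≟ (to T-∧ e))))
...     | inj₂ e = inj₂ (inj₂ (inj₂ (Data.Product.map T-≟ T-≟ (to T-∧ e))))

module _ (n i j : ℕ) where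
  private
    a₁ = ⌊ suc i ≟ j ⌋
    a₂ = ⌊ suc j ≟ i ⌋
    a₃ = ⌊ i ≟ 0 ⌋ ∧ ⌊ suc j ≟ n ⌋
    a₄ = ⌊ j ≟ 0 ⌋ ∧ ⌊ suc i ≟ n ⌋

  cases⇒adjacent : AdjCases n i j → Adj n i j
  cases⇒adjacent (inj₁ e) = from (T-∨ {a₁}) (inj₁ (≟-T e))
  cases⇒adjacent (inj₂ c) = from (T-∨ {a₁}) (inj₂ (rest c))
    where
    rest : (suc j ≡ i) ⊎ (i ≡ 0 × suc j ≡ n) ⊎ (j ≡ 0 × suc i ≡ n) → T (a₂ ∨ a₃ ∨ a₄)
    rest (inj₁ e)                  = from (T-∨ {a₂}) (inj₁ (≟-T e))
    rest (inj₂ (inj₁ (e , f)))     = from (T-∨ {a₂}) (inj₂ (from (T-∨ {a₃}) (inj₁ (from T-∧ (≟-T e , ≟-T f)))))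
    rest (inj₂ (inj₂ (e , f)))     = from (T-∨ {a₂}) (inj₂ (from (T-∨ {a₃}) (inj₂ (from T-∧ (≟-T e , ≟-T f)))))

adjacent-sym : ∀ n i j → Adj n i j → Adj n j i
adjacent-sym n i j a with adjacent⇒cases n i j a
... | inj₁ e                  = cases⇒adjacent n j i (inj₂ (inj₁ e))
... | inj₂ (inj₁ e)           = cases⇒adjacent n j i (inj₁ e)
... | inj₂ (inj₂ (inj₁ e))    = cases⇒adjacent n j i (inj₂ (inj₂ (inj₂ e)))
... | inj₂ (inj₂ (inj₂ e))    = cases⇒adjacent n j i (inj₂ (inj₂ (inj₁ e)))

adjacent-irrefl : ∀ n i → 2 ≤ n → ¬ Adj n i i
adjacent-irrefl n i n≥2 a with adjacent⇒cases n i i a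
... | inj₁ e                             = 1+n≢n e
... | inj₂ (inj₁ e)                      = 1+n≢n e
... | inj₂ (inj₂ (inj₁ (refl , refl)))   = <-irrefl refl n≥2
... | inj₂ (inj₂ (inj₂ (refl , refl)))   = <-irrefl refl n≥2

next : ℕ → ℕ → ℕ
next n i = if suc i ≡ᵇ n then 0 else suc i

prev : ℕ → ℕ → ℕ
prev n zero    = n ∸ 1
prev n (suc i) = i

next-last : ∀ n i → suc i ≡ n → next n i ≡ 0
next-last n i e with suc i ≡ᵇ n in eq
... | true  = refl
... | false = ⊥-elim (subst T eq (≡⇒≡ᵇ (suc i) n e))

next-inner : ∀ n i → suc i < n → next n i ≡ suc i
next-inner n i lt with suc i ≡ᵇ n in eq
... | true  = ⊥-elim (<-irrefl (≡ᵇ⇒≡ (suc i) n (T-true eq)) lt)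
... | false = refl

next-cases : ∀ n i → i < n → (suc i ≡ n × next n i ≡ 0) ⊎ (suc i < n × next n i ≡ suc i)
next-cases n i lt with m≤n⇒m<n∨m≡n lt
... | inj₁ l = inj₂ (l , next-inner n i l)
... | inj₂ e = inj₁ (e , next-last n i e)

next< : ∀ n i → i < n → next n i < n
next< n i lt with next-cases n i lt
... | inj₁ (_ , r) = subst (_< n) (sym r) (≤-trans (s≤s z≤n) lt)
... | inj₂ (l , r) = subst (_< n) (sym r) l

prev< : ∀ n i → i < n → prev n i < n
prev< (suc n) zero    _  = ≤-refl
prev< n       (suc i) lt = <-trans (n<1+n i) lt

adjacent-next : ∀ n i → i < n → Adj n i (next n i)
adjacent-next n i lt with next-cases n i lt
... | inj₁ (e , r) = subst (Adj n i) (sym r) (cases⇒adjacent n i 0 (inj₂ (inj₂ (inj₂ (refl , e)))))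
... | inj₂ (_ , r) = subst (Adj n i) (sym r) (cases⇒adjacent n i (suc i) (inj₁ refl))

adjacent-prev : ∀ n i → i < n → Adj n i (prev n i)
adjacent-prev (suc n) zero    _ = cases⇒adjacent (suc n) 0 n (inj₂ (inj₂ (inj₁ (refl , refl))))
adjacent-prev n       (suc i) _ = cases⇒adjacent n (suc i) i (inj₂ (inj₁ refl))

adjacent⇒next-or-prev : ∀ n i j → i < n → j < n → Adj n i j → (j ≡ next n i) ⊎ (j ≡ prev n i)
adjacent⇒next-or-prev n i j i<n j<n a with adjacent⇒cases n i j a
... | inj₁ e                            = inj₁ (trans (sym e) (sym (next-inner n i (subst (_< n) (sym e) j<n))))
... | inj₂ (inj₁ refl)                  = inj₂ refl
... | inj₂ (inj₂ (inj₁ (refl , e)))     = inj₂ (cong (_∸ 1) e)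
... | inj₂ (inj₂ (inj₂ (refl , e)))     = inj₁ (sym (next-last n i e))

next≢prev : ∀ n i → 3 ≤ n → i < n → next n i ≢ prev n i
next≢prev (suc zero)          zero    (s≤s ())         _ _
next≢prev (suc (suc zero))    zero    (s≤s (s≤s ()))   _ _
next≢prev (suc (suc (suc n))) zero    _   _  ()
next≢prev n                   (suc i) n≥3 lt eq with next-cases n (suc i) lt
... | inj₁ (e , r) with trans (sym r) eq
...   | refl = <⇒≱ (subst (_< 3) e ≤-refl) n≥3
next≢prev n (suc i) n≥3 lt eq | inj₂ (_ , r) =
  <-irrefl (sym (trans (sym r) eq)) (<-trans (n<1+n i) (n<1+n (suc i)))

degree-two : ∀ n i → 3 ≤ n → i < n → count n (cycleAdjℕ n i) ≡ 2
degree-two n i n≥3 i<n =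
  begin
    count n (cycleAdjℕ n i)
  ≡⟨ count-ext n neighbours ⟩
    count n (λ j → ⌊ j ≟ next n i ⌋ ∨ ⌊ j ≟ prev n i ⌋)
  ≡⟨ count-∨ n _ _ (λ j a b → next≢prev n i n≥3 i<n (trans (sym (T-≟ a)) (T-≟ b))) ⟩
    count n (λ j → ⌊ j ≟ next n i ⌋) + count n (λ j → ⌊ j ≟ prev n i ⌋)
  ≡⟨ cong₂ _+_ (count-point n _ (next< n i i<n)) (count-point n _ (prev< n i i<n)) ⟩
    2
  ∎
  where
  open ≡-Reasoning
  neighbours : ∀ j → j < n → cycleAdjℕ n i j ≡ (⌊ j ≟ next n i ⌋ ∨ ⌊ j ≟ prev n i ⌋)
  neighbours j j<n = T-ext ⇒ ⇐
    where
    ⇒ : Adj n i j → T (⌊ j ≟ next n i ⌋ ∨ ⌊ j ≟ prev n i ⌋)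
    ⇒ a = from (T-∨ {⌊ j ≟ next n i ⌋}) (Data.Sum.map (≟-T {j}) (≟-T {j}) (adjacent⇒next-or-prev n i j i<n j<n a))
    ⇐ : T (⌊ j ≟ next n i ⌋ ∨ ⌊ j ≟ prev n i ⌋) → Adj n i j
    ⇐ t with to (T-∨ {⌊ j ≟ next n i ⌋}) t
    ... | inj₁ e = subst (Adj n i) (sym (T-≟ {j} e)) (adjacent-next n i i<n)
    ... | inj₂ e = subst (Adj n i) (sym (T-≟ {j} e)) (adjacent-prev n i i<n)

-- The bit at position i (false beyond the length).
bit : ∀ {k} → Vec Bool k → ℕ → Bool
bit []      _       = false
bit (b ∷ S) zero    = b
bit (b ∷ S) (suc i) = bit S i

inB-bit : ∀ {k} (v : Fin k) (S : Vec Bool k) → inB v S ≡ bit S (toℕ v)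
inB-bit F.zero    (true ∷ S)  = refl
inB-bit F.zero    (false ∷ S) = refl
inB-bit (F.suc v) (b ∷ S)     = trans (isYes≗does _) (trans (sym (isYes≗does _)) (inB-bit v S))

bit-∁ : ∀ {k} (S : Vec Bool k) j → j < k → bit (∁ S) j ≡ not (bit S j)
bit-∁ (b ∷ S) zero    _        = refl
bit-∁ (b ∷ S) (suc j) (s≤s lt) = bit-∁ S j lt

size-count : ∀ {k} (S : Vec Bool k) → size S ≡ count k (bit S)
size-count []      = refl
size-count (b ∷ S) = cong ([ b ]ᵇ +_) (size-count S)

linearEnds-count : ∀ {k} (S : Vec Bool (suc k)) →
  linearEnds S ≡ count k (λ j → bit S j ∧ not (bit S (suc j)))
linearEnds-count (true ∷ [])  = refl
linearEnds-count (false ∷ []) = refl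
linearEnds-count (b ∷ c ∷ S)  = cong ([ b ∧ not c ]ᵇ +_) (linearEnds-count (c ∷ S))

bit-last : ∀ {k} (S : Vec Bool (suc k)) → bit S k ≡ last S
bit-last (b ∷ [])    = refl
bit-last (b ∷ c ∷ S) = bit-last (c ∷ S)

bit-head : ∀ {k} (S : Vec Bool (suc k)) → bit S 0 ≡ head S
bit-head (b ∷ S) = refl

RightEnd : ℕ → (ℕ → Bool) → ℕ → Bool
RightEnd n s i = s i ∧ not (s (next n i))

cyclicEnds : ∀ {k} → ℕ → Vec Bool k → ℕ
cyclicEnds n S = count n (RightEnd n (bit S))

cyclicEnds-linear : ∀ m (S : Vec Bool (suc m)) →
  cyclicEnds (suc m) S ≡ linearEnds S + [ last S ∧ not (head S) ]ᵇ
cyclicEnds-linear m S =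
  trans (count-snoc m _)
        (cong₂ _+_ (trans (count-ext m inner) (sym (linearEnds-count S)))
                   (cong [_]ᵇ (trans (cong (λ z → bit S m ∧ not (bit S z)) (next-last (suc m) m refl))
                                     (cong₂ (λ a b → a ∧ not b) (bit-last S) (bit-head S)))))
  where
  inner : ∀ j → j < m → RightEnd (suc m) (bit S) j ≡ (bit S j ∧ not (bit S (suc j)))
  inner j j<m = cong (λ z → bit S j ∧ not (bit S z)) (next-inner (suc m) j (s≤s j<m))

max-constant : ∀ {A : Set} (f : A → ℕ) c x xs → (∀ y → f y ≡ c) →
  List.foldr _⊔_ 0 (List.map f (x ∷ xs)) ≡ c
max-constant f c x []       e rewrite e x = ⊔-identityʳ c
max-constant f c x (y ∷ xs) e rewrite e x | max-constant f c y xs e = ⊔-idem c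

δ₁-cycle : ∀ n → 3 ≤ n → δ₁ (cycleGraph n) ≡ 2
δ₁-cycle (suc k) n≥3 =
  max-constant (deg (cycleGraph (suc k))) 2 F.zero (List.tabulate {n = k} F.suc) degree
  where
  degree : ∀ v → deg (cycleGraph (suc k)) v ≡ 2
  degree v = trans (countB-tabulate (suc k) (λ i → i) _ (cycleAdjℕ (suc k) (toℕ v)) (λ _ → refl))
                   (degree-two (suc k) (toℕ v) n≥3 (toℕ<n v))

module CycleDegrees (n : ℕ) (n≥3 : 3 ≤ n) where

  NeighbourIn : Subset n → Fin n → ℕ → Bool
  NeighbourIn U v j = cycleAdjℕ n (toℕ v) j ∧ bit U j

  δ-count : ∀ (U : Subset n) (v : Fin n) → δ (cycleGraph n) U v ≡ count n (NeighbourIn U v)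
  δ-count U v = countB-tabulate n (λ i → i) _ _ (λ i → cong (cycleAdjℕ n (toℕ v) (toℕ i) ∧_) (inB-bit i U))

  -- C_n is 2-regular: the neighbours of v split between S and its complement.
  δ-split : ∀ (S : Subset n) v → δ (cycleGraph n) S v + δ (cycleGraph n) (∁ S) v ≡ 2
  δ-split S v =
    trans (cong₂ _+_ (δ-count S v)
                     (trans (δ-count (∁ S) v)
                            (count-ext n (λ j lt → cong (cycleAdjℕ n (toℕ v) j ∧_) (bit-∁ S j lt)))))
          (trans (sym (count-split n _ (bit S))) (degree-two n (toℕ v) n≥3 (toℕ<n v)))

-- Exact alliance indices in 2-regular graphs

window : List ℤ
window = -[1+ 1 ] ∷ -[1+ 0 ] ∷ ℤ.+ 0 ∷ ℤ.+ 1 ∷ ℤ.+ 2 ∷ []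

kS-unfold : ∀ (P : ℤ → Bool) d → d ≡ 2 →
  maxℤ (ℤ.- (ℤ.+ d)) (List.filter (λ k → T? (P k)) (List.map (λ i → (ℤ.- (ℤ.+ d)) ℤ.+ (ℤ.+ i)) (List.upTo (suc (2 ℕ.* d)))))
    ≡ maxℤ -[1+ 1 ] (List.filter (λ k → T? (P k)) window)
kS-unfold P .2 refl = refl

window-max≡-2 : (f : ℤ → Bool) → f -[1+ 1 ] ≡ true → f -[1+ 0 ] ≡ false → f (ℤ.+ 0) ≡ false →
  f (ℤ.+ 1) ≡ false → f (ℤ.+ 2) ≡ false → maxℤ -[1+ 1 ] (List.filter (λ k → T? (f k)) window) ≡ -[1+ 1 ]
window-max≡-2 f a b c d e rewrite a | b | c | d | e = refl

window-max≡0 : (f : ℤ → Bool) → f -[1+ 1 ] ≡ true → f -[1+ 0 ] ≡ true → f (ℤ.+ 0) ≡ true →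
  f (ℤ.+ 1) ≡ false → f (ℤ.+ 2) ≡ false → maxℤ -[1+ 1 ] (List.filter (λ k → T? (f k)) window) ≡ ℤ.+ 0
window-max≡0 f a b c d e rewrite a | b | c | d | e = refl

window-max≡2 : (f : ℤ → Bool) → f -[1+ 1 ] ≡ true → f -[1+ 0 ] ≡ true → f (ℤ.+ 0) ≡ true →
  f (ℤ.+ 1) ≡ true → f (ℤ.+ 2) ≡ true → maxℤ -[1+ 1 ] (List.filter (λ k → T? (f k)) window) ≡ ℤ.+ 2
window-max≡2 f a b c d e rewrite a | b | c | d | e = refl

one-or-two : ∀ {a b} → a + b ≡ 2 → 1 ≤ a → a ≡ 1 ⊎ a ≡ 2
one-or-two {1}               _  _ = inj₁ refl
one-or-two {2}               _  _ = inj₂ refl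
one-or-two {suc (suc (suc _))} () _

both-one : ∀ {a b} → a + b ≡ 2 → 1 ≤ a → 1 ≤ b → a ≡ 1
both-one {a} {b} a+b a≥1 b≥1 with one-or-two a+b a≥1
... | inj₁ a≡1 = a≡1
... | inj₂ refl with b≥1 | a+b
...   | s≤s _ | ()

-- In a graph with δ₁ = 2 in which every vertex has two neighbours, k_S depends
-- only on the least number of neighbours a vertex of S has inside S.
module TwoRegular (Γ : Graph) (δ₁≡2 : δ₁ Γ ≡ 2)
                  (δ-split : ∀ S v → δ Γ S v + δ Γ (∁ S) v ≡ 2) where

  Holds : Subset (order Γ) → ℤ → Fin (order Γ) → Set
  Holds S k v = T ⌊ (ℤ.+ δ Γ (∁ S) v) ℤ.+ k ℤ.≤? ℤ.+ δ Γ S v ⌋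

  alliance : ∀ S k → (∀ v → T (inB v S) → Holds S k v) → isDefAlliance Γ S k ≡ true
  alliance S k h = trans (isYes≗does _) (dec-true (all? _) at)
    where
    at : ∀ v → T (not (inB v S) ∨ ⌊ (ℤ.+ δ Γ (∁ S) v) ℤ.+ k ℤ.≤? ℤ.+ δ Γ S v ⌋)
    at v with inB v S | h v
    ... | true  | hv = hv tt
    ... | false | _  = tt

  not-alliance : ∀ S k v → T (inB v S) → ¬ Holds S k v → isDefAlliance Γ S k ≡ false
  not-alliance S k v v∈S fails = trans (isYes≗does _) (dec-false (all? _) (λ all → fails (at (all v))))
    where
    at : T (not (inB v S) ∨ ⌊ (ℤ.+ δ Γ (∁ S) v) ℤ.+ k ℤ.≤? ℤ.+ δ Γ S v ⌋) → Holds S k v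
    at t with inB v S
    ... | true  = t
    ... | false = ⊥-elim v∈S

  -- δ_S(v) = a forces δ_{S̄}(v) = 2 - a, so the condition is a comparison of numerals.
  complement-degree : ∀ S v a b → a + b ≡ 2 → δ Γ S v ≡ a → δ Γ (∁ S) v ≡ b
  complement-degree S v a b a+b e =
    +-cancelˡ-≡ a _ _ (trans (cong (_+ δ Γ (∁ S) v) (sym e)) (trans (δ-split S v) (sym a+b)))

  holds-at : ∀ S k v a b → a + b ≡ 2 → δ Γ S v ≡ a → T ⌊ (ℤ.+ b) ℤ.+ k ℤ.≤? ℤ.+ a ⌋ → Holds S k v
  holds-at S k v a b a+b e t =
    subst₂ (λ x y → T ⌊ (ℤ.+ y) ℤ.+ k ℤ.≤? ℤ.+ x ⌋) (sym e) (sym (complement-degree S v a b a+b e)) t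

  fails-at : ∀ S k v a b → a + b ≡ 2 → δ Γ S v ≡ a → ¬ T ⌊ (ℤ.+ b) ℤ.+ k ℤ.≤? ℤ.+ a ⌋ → ¬ Holds S k v
  fails-at S k v a b a+b e f t =
    f (subst₂ (λ x y → T ⌊ (ℤ.+ y) ℤ.+ k ℤ.≤? ℤ.+ x ⌋) e (complement-degree S v a b a+b e) t)

  kS-window-of : ∀ S → kS Γ S ≡ maxℤ -[1+ 1 ] (List.filter (λ k → T? (isDefAlliance Γ S k)) window)
  kS-window-of S = kS-unfold (isDefAlliance Γ S) (δ₁ Γ) δ₁≡2

  kS-isolated : ∀ S → (∀ v → T (inB v S) → δ Γ S v ≡ 0) → (v₀ : Fin (order Γ)) → T (inB v₀ S) →
    kS Γ S ≡ -[1+ 1 ]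
  kS-isolated S isolated v₀ v₀∈S = trans (kS-window-of S) (window-max≡-2 (isDefAlliance Γ S)
      (alliance S -[1+ 1 ] (λ v v∈S → holds-at S -[1+ 1 ] v 0 2 refl (isolated v v∈S) tt))
      (reject -[1+ 0 ] (λ ())) (reject (ℤ.+ 0) (λ ())) (reject (ℤ.+ 1) (λ ())) (reject (ℤ.+ 2) (λ ())))
    where
    reject : ∀ k → ¬ T ⌊ (ℤ.+ 2) ℤ.+ k ℤ.≤? ℤ.+ 0 ⌋ → isDefAlliance Γ S k ≡ false
    reject k f = not-alliance S k v₀ v₀∈S (fails-at S k v₀ 0 2 refl (isolated v₀ v₀∈S) f)

  kS-leaf : ∀ S → (∀ v → T (inB v S) → 1 ≤ δ Γ S v) → (v₀ : Fin (order Γ)) → T (inB v₀ S) →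
    δ Γ S v₀ ≡ 1 → kS Γ S ≡ ℤ.+ 0
  kS-leaf S linked v₀ v₀∈S leaf = trans (kS-window-of S) (window-max≡0 (isDefAlliance Γ S)
      (accept -[1+ 1 ] tt tt) (accept -[1+ 0 ] tt tt) (accept (ℤ.+ 0) tt tt)
      (reject (ℤ.+ 1) (λ ())) (reject (ℤ.+ 2) (λ ())))
    where
    -- δ_S(v) is 1 or 2 on S, so a condition satisfied in both profiles holds.
    accept : ∀ k → T ⌊ (ℤ.+ 1) ℤ.+ k ℤ.≤? ℤ.+ 1 ⌋ → T ⌊ (ℤ.+ 0) ℤ.+ k ℤ.≤? ℤ.+ 2 ⌋ →
      isDefAlliance Γ S k ≡ true
    accept k one two = alliance S k at
      where
      at : ∀ v → T (inB v S) → Holds S k v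
      at v v∈S with one-or-two (δ-split S v) (linked v v∈S)
      ... | inj₁ e = holds-at S k v 1 1 refl e one
      ... | inj₂ e = holds-at S k v 2 0 refl e two
    reject : ∀ k → ¬ T ⌊ (ℤ.+ 1) ℤ.+ k ℤ.≤? ℤ.+ 1 ⌋ → isDefAlliance Γ S k ≡ false
    reject k f = not-alliance S k v₀ v₀∈S (fails-at S k v₀ 1 1 refl leaf f)

  kS-full : ∀ S → (∀ v → δ Γ S v ≡ 2) → kS Γ S ≡ ℤ.+ 2
  kS-full S full = trans (kS-window-of S) (window-max≡2 (isDefAlliance Γ S)
      (accept -[1+ 1 ] tt) (accept -[1+ 0 ] tt) (accept (ℤ.+ 0) tt) (accept (ℤ.+ 1) tt) (accept (ℤ.+ 2) tt))
    where
    accept : ∀ k → T ⌊ (ℤ.+ 0) ℤ.+ k ℤ.≤? ℤ.+ 2 ⌋ → isDefAlliance Γ S k ≡ true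
    accept k t = alliance S k (λ v _ → holds-at S k v 2 0 refl (full v) t)

-- Connectivity of subsets of C_n

-- Throughout, s is the characteristic function of a subset of the vertices
-- {0, …, m} of C_(m+1).
module Walks (m : ℕ) (s : ℕ → Bool) where

  private
    n = suc m

  -- Walks of length at most t that stay inside s (the start vertex excepted).
  data Walk : ℕ → ℕ → ℕ → Set where
    stay : ∀ {t i} → Walk t i i
    hop  : ∀ {t i j k} → Adj n i j → T (s j) → j < n → Walk t j k → Walk (suc t) i k

  weaken : ∀ {t t′ i k} → Walk t i k → t ≤ t′ → Walk t′ i k
  weaken stay          _          = stay
  weaken (hop a b c w) (s≤s t≤t′) = hop a b c (weaken w t≤t′)

  _++_ : ∀ {t₁ t₂ i j k} → Walk t₁ i j → Walk t₂ j k → Walk (t₁ + t₂) i k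
  _++_ {t₁} stay w = weaken w (m≤n+m _ t₁)
  hop a b c w ++ w′ = hop a b c (w ++ w′)

  append : ∀ {t i j k} → Walk t i j → Adj n j k → T (s k) → k < n → Walk (suc t) i k
  append stay          a′ b′ c′ = hop a′ b′ c′ stay
  append (hop a b c w) a′ b′ c′ = hop a b c (append w a′ b′ c′)

  reverse : ∀ {t i k} → T (s i) → i < n → Walk t i k → Walk t k i
  reverse si i<n stay = stay
  reverse {i = i} si i<n (hop {j = j} a b c w) = append (reverse b c w) (adjacent-sym n i j a) si i<n

  first-step : ∀ {t v w} → Walk t v w → v ≢ w → Σ ℕ λ j → Adj n v j × T (s j) × j < n
  first-step stay              v≢w = ⊥-elim (v≢w refl)
  first-step (hop {j = j} a b c _) _ = j , a , b , c

  End : ℕ → Bool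
  End = RightEnd n s

  End⇒∈ : ∀ i → T (End i) → T (s i)
  End⇒∈ i t = proj₁ (to T-∧ t)

  End⇒next∉ : ∀ i → T (End i) → ¬ T (s (next n i))
  End⇒next∉ i t = T-not (proj₂ (to (T-∧ {s i}) t))

  AtMostOneEnd : Set
  AtMostOneEnd = count n End ≤ 1

  two-ends : ∀ i j → i < j → j < n → T (End i) → T (End j) → ¬ AtMostOneEnd
  two-ends i j i<j j<n ei ej le with ≤-trans (count-≥2 n End i j i<j j<n ei ej) le
  ... | s≤s ()

  Filled : ℕ → ℕ → Set
  Filled a d = ∀ j → j ≤ d → T (s (a + j))

  scan : ∀ d a → a + d < n → T (s a) → Filled a d ⊎ (Σ ℕ λ i → i < d × T (End (a + i)))
  scan zero a _ sa = inj₁ (λ { zero _ → subst (λ z → T (s z)) (sym (+-identityʳ a)) sa })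
  scan (suc d) a lt sa with s (suc a) in eq
  ... | true with scan d (suc a) (subst (_< n) (+-suc a d) lt) (T-true eq)
  ...   | inj₁ f = inj₁ filled
    where
    filled : Filled a (suc d)
    filled zero    _         = subst (λ z → T (s z)) (sym (+-identityʳ a)) sa
    filled (suc j) (s≤s j≤d) = subst (λ z → T (s z)) (sym (+-suc a j)) (f j j≤d)
  ...   | inj₂ (i , i<d , e) = inj₂ (suc i , s≤s i<d , subst (λ z → T (End z)) (sym (+-suc a i)) e)
  scan (suc d) a lt sa | false =
    inj₂ (0 , s≤s z≤n , subst (λ z → T (End z)) (sym (+-identityʳ a)) end)
    where
    a+1<n : suc a < n
    a+1<n = ≤-<-trans (s≤s (m≤m+n a d)) (subst (_< n) (+-suc a d) lt)
    end : T (End a)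
    end rewrite next-inner n a a+1<n | eq = from T-∧ (sa , tt)

  straight : ∀ d a → a + d < n → Filled a d → Walk d a (a + d)
  straight zero a _ _ = subst (Walk 0 a) (sym (+-identityʳ a)) stay
  straight (suc d) a lt f =
    subst (Walk (suc d) a) (sym (+-suc a d))
      (hop (cases⇒adjacent n a (suc a) (inj₁ refl))
           (subst (λ z → T (s z)) (+-comm a 1) (f 1 (s≤s z≤n)))
           (≤-<-trans (s≤s (m≤m+n a d)) lt′)
           (straight d (suc a) lt′ (λ j j≤d → subst (λ z → T (s z)) (+-suc a j) (f (suc j) (s≤s j≤d)))))
    where
    lt′ : suc a + d < n
    lt′ = subst (_< n) (+-suc a d) lt

  -- With at most one right end, two vertices u ≤ v of s are joined through s
  -- either directly, or around the cycle through m and 0.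
  covered : AtMostOneEnd → ∀ u d → u + d < n → T (s u) → T (s (u + d)) →
    Filled u d ⊎ (Filled (u + d) (m ∸ (u + d)) × Filled 0 u)
  covered le u d lt su sv with scan d u lt su
  ... | inj₁ f = inj₁ f
  ... | inj₂ (i , i<d , eᵢ) with scan (m ∸ v) v v+e<n sv
    where
    v = u + d
    v+e<n : v + (m ∸ v) < n
    v+e<n = s≤s (≤-reflexive (m+[n∸m]≡n (s≤s⁻¹ lt)))
  ...   | inj₂ (i′ , i′<e , eᵢ′) =
    ⊥-elim (two-ends (u + i) (u + d + i′) (≤-trans (+-monoʳ-< u i<d) (m≤m+n _ i′))
                     (≤-<-trans (+-monoʳ-≤ (u + d) (<⇒≤ i′<e)) (s≤s (≤-reflexive (m+[n∸m]≡n (s≤s⁻¹ lt)))))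
                     eᵢ eᵢ′ le)
  ...   | inj₁ f′ with T? (s 0)
  ...     | no 0∉s = ⊥-elim (two-ends (u + i) m (≤-trans (+-monoʳ-< u i<d) (s≤s⁻¹ lt)) ≤-refl eᵢ end-m le)
    where
    -- m is a right end because 0 ∉ s.
    end-m : T (End m)
    end-m rewrite next-last n m refl | false-¬T 0∉s =
      from T-∧ (subst (λ z → T (s z)) (m+[n∸m]≡n (s≤s⁻¹ lt)) (f′ (m ∸ (u + d)) ≤-refl) , tt)
  ...     | yes 0∈s with scan u 0 (≤-<-trans (m≤m+n u d) lt) 0∈s
  ...       | inj₁ f″ = inj₂ (f′ , f″)
  ...       | inj₂ (i″ , i″<u , eᵢ″) =
    ⊥-elim (two-ends i″ (u + i) (≤-trans i″<u (m≤m+n u i)) (<-trans (+-monoʳ-< u i<d) lt) eᵢ″ eᵢ le)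

  joined-upward : AtMostOneEnd → ∀ u d → u + d < n → T (s u) → T (s (u + d)) → Walk n u (u + d)
  joined-upward le u d lt su sv with covered le u d lt su sv
  ... | inj₁ f          = weaken (straight d u lt f) (≤-trans (m≤n+m d u) (<⇒≤ lt))
  ... | inj₂ (f′ , f″) = reverse sv lt (weaken (to-m ++ (hop wrap (f″ 0 z≤n) (s≤s z≤n) to-u)) bound)
    where
    v = u + d
    e = m ∸ v
    v+e≡m : v + e ≡ m
    v+e≡m = m+[n∸m]≡n (s≤s⁻¹ lt)
    to-m : Walk e v m
    to-m = subst (Walk e v) v+e≡m (straight e v (s≤s (≤-reflexive v+e≡m)) f′)
    wrap : Adj n m 0
    wrap = cases⇒adjacent n m 0 (inj₂ (inj₂ (inj₂ (refl , refl))))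
    to-u : Walk u 0 u
    to-u = straight u 0 (≤-<-trans (m≤m+n u d) lt) f″
    bound : e + suc u ≤ n
    bound = subst (_≤ n) (sym (+-suc e u))
              (s≤s (subst (e + u ≤_) (trans (+-comm e v) v+e≡m) (+-monoʳ-≤ e (m≤m+n u d))))

  joined : AtMostOneEnd → ∀ u v → u < n → v < n → T (s u) → T (s v) → Walk n u v
  joined le u v u<n v<n su sv with ≤-total u v
  ... | inj₁ u≤v = subst (Walk n u) (m+[n∸m]≡n u≤v)
      (joined-upward le u (v ∸ u) (subst (_< n) (sym (m+[n∸m]≡n u≤v)) v<n) su
                     (subst (λ z → T (s z)) (sym (m+[n∸m]≡n u≤v)) sv))
  ... | inj₂ v≤u = reverse sv v<n (subst (Walk n v) (m+[n∸m]≡n v≤u)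
      (joined-upward le v (u ∸ v) (subst (_< n) (sym (m+[n∸m]≡n v≤u)) u<n) sv
                     (subst (λ z → T (s z)) (sym (m+[n∸m]≡n v≤u)) su)))

  -- Two right ends a < b cut off the arc a+2, …, b: a step inside s that
  -- starts in this arc stays in it (its ends a+1 and b+1 are not in s).
  module Separation (a b : ℕ) (a<b : a < b) (b<n : b < n) (ea : T (End a)) (eb : T (End b)) where

    Inside : ℕ → Set
    Inside x = suc a < x × x ≤ b

    a+1∉s : ¬ T (s (suc a))
    a+1∉s = subst (λ z → ¬ T (s z)) (next-inner n a (≤-<-trans a<b b<n)) (End⇒next∉ a ea)

    b-inside : Inside b
    b-inside with m≤n⇒m<n∨m≡n a<b
    ... | inj₁ a+1<b = a+1<b , ≤-refl
    ... | inj₂ refl  = ⊥-elim (a+1∉s (End⇒∈ b eb))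

    a-outside : ¬ Inside a
    a-outside (a+1<a , _) = <-irrefl refl (<-trans (n<1+n a) a+1<a)

    step-inside : ∀ x y → y < n → Inside x → Adj n x y → T (s y) → Inside y
    step-inside x y y<n (a+1<x , x≤b) adj sy with adjacent⇒cases n x y adj
    ... | inj₁ refl with m≤n⇒m<n∨m≡n x≤b
    ...   | inj₁ x<b = <-trans a+1<x (n<1+n x) , x<b
    ...   | inj₂ refl with next-cases n x b<n
    ...     | inj₁ (x+1≡n , _) = ⊥-elim (<-irrefl x+1≡n y<n)
    ...     | inj₂ (_ , r)     = ⊥-elim (End⇒next∉ x eb (subst (λ z → T (s z)) (sym r) sy))
    step-inside x y y<n (a+1<x , x≤b) adj sy | inj₂ (inj₁ refl) with m≤n⇒m<n∨m≡n (s≤s⁻¹ a+1<x)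
    ... | inj₁ a+1<y = a+1<y , ≤-trans (n≤1+n y) x≤b
    ... | inj₂ refl  = ⊥-elim (a+1∉s sy)
    step-inside x y y<n (() , x≤b) adj sy | inj₂ (inj₂ (inj₁ (refl , _)))
    step-inside x y y<n (a+1<x , x≤b) adj sy | inj₂ (inj₂ (inj₂ (refl , x+1≡n))) =
      ⊥-elim (End⇒next∉ b eb (subst (λ z → T (s z)) (sym (next-last n b b+1≡n)) sy))
      where
      b+1≡n : suc b ≡ n
      b+1≡n = ≤-antisym b<n (subst (_≤ suc b) x+1≡n (s≤s x≤b))

module Predicates (Γ : Graph) (S : Subset (order Γ)) where

  nonempty-intro : (v : Fin (order Γ)) → T (inB v S) → nonemptyB S ≡ true
  nonempty-intro v v∈S = true-T (fromWitness (v , v∈S))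

  nonempty-false : (∀ v → ¬ T (inB v S)) → nonemptyB S ≡ false
  nonempty-false empty = false-¬T (λ t → empty (proj₁ (toWitness t)) (proj₂ (toWitness t)))

  connected-intro : (∀ u v → T (inB u S) → T (inB v S) → T (walkWithin Γ S (order Γ) u v)) →
    connectedB Γ S ≡ true
  connected-intro walk = true-T (fromWitness (λ u → fromWitness (λ v → implication (walk u v))))
    where
    implication : ∀ {a b w} → (T a → T b → T w) → T (not (a ∧ b) ∨ w)
    implication {true}  {true}  f = f tt tt
    implication {true}  {false} _ = tt
    implication {false}         _ = tt

  connected-elim : connectedB Γ S ≡ true → ∀ u v → T (inB u S) → T (inB v S) →
    T (walkWithin Γ S (order Γ) u v)
  connected-elim c u v u∈S v∈S = modus-ponens (toWitness (toWitness (T-true c) u) v) u∈S v∈S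
    where
    modus-ponens : ∀ {a b w} → T (not (a ∧ b) ∨ w) → T a → T b → T w
    modus-ponens {true} {true} t _ _ = t

  walk-closed : (P : Fin (order Γ) → Set) → (∀ x y → P x → T (adj Γ x y) → T (inB y S) → P y) →
    ∀ t u v → T (walkWithin Γ S t u v) → P u → P v
  walk-closed P step zero    u v w pu = subst P (toℕ-injective (T-≟ w)) pu
  walk-closed P step (suc t) u v w pu with to T-∨ w
  ... | inj₁ u≡v = subst P (toℕ-injective (T-≟ u≡v)) pu
  ... | inj₂ e with toWitness e
  ...   | x , t′ with to T-∧ t′
  ...     | u~x , rest with to T-∧ rest
  ...       | x∈S , walk = walk-closed P step t x v walk (step u x pu u~x x∈S)

-- Classification of the subsets of C_n

⌊+≟+⌋ : ∀ a b → ⌊ ℤ.+ a ℤ.≟ ℤ.+ b ⌋ ≡ ⌊ b ≟ a ⌋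
⌊+≟+⌋ a b = T-ext (λ t → ≟-T (sym (ℤP.+-injective (toWitness t))))
                  (λ t → fromWitness (cong ℤ.+_ (sym (T-≟ {b} t))))

module Classify (m : ℕ) (n≥3 : 3 ≤ suc m) (S : Vec Bool (suc m)) where

  private
    n = suc m
    Γ = cycleGraph n

  open CycleDegrees n n≥3
  open TwoRegular Γ (δ₁-cycle n n≥3) δ-split
  open Walks m (bit S)
  open Predicates Γ S

  n≥2 : 2 ≤ n
  n≥2 = ≤-trans (s≤s (s≤s z≤n)) n≥3

  vertex : ∀ j → j < n → Fin n
  vertex j lt = fromℕ< lt

  inB-vertex : ∀ j (lt : j < n) → inB (vertex j lt) S ≡ bit S j
  inB-vertex j lt = trans (inB-bit (vertex j lt) S) (cong (bit S) (toℕ-fromℕ< lt))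

  ∈-vertex : ∀ j (lt : j < n) → T (bit S j) → T (inB (vertex j lt) S)
  ∈-vertex j lt = subst T (sym (inB-vertex j lt))

  ∈-bit : ∀ v → T (inB v S) → T (bit S (toℕ v))
  ∈-bit v = subst T (inB-bit v S)

  walkWithin-from : ∀ t (u v : Fin n) {i k} → Walk t i k → toℕ u ≡ i → toℕ v ≡ k →
    T (walkWithin Γ S t u v)
  walkWithin-from zero    u v stay eu ev = ≟-T (trans eu (sym ev))
  walkWithin-from (suc t) u v stay eu ev = from (T-∨ {⌊ toℕ u ≟ toℕ v ⌋}) (inj₁ (≟-T (trans eu (sym ev))))
  walkWithin-from (suc t) u v (hop {j = j} a j∈S j<n w) eu ev =
    from (T-∨ {⌊ toℕ u ≟ toℕ v ⌋})
      (inj₂ (fromWitness (x , from (T-∧ {adj Γ u x}) (u~x , from (T-∧ {inB x S}) (∈-vertex j j<n j∈S , rest)))))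
    where
    x = vertex j j<n
    u~x : T (adj Γ u x)
    u~x = subst₂ (λ p q → T (cycleAdjℕ n p q)) (sym eu) (sym (toℕ-fromℕ< j<n)) a
    rest : T (walkWithin Γ S t x v)
    rest = walkWithin-from t x v w (toℕ-fromℕ< j<n) ev

  connected : AtMostOneEnd → connectedB Γ S ≡ true
  connected le = connected-intro (λ u v u∈S v∈S → walkWithin-from n u v
    (joined le (toℕ u) (toℕ v) (toℕ<n u) (toℕ<n v) (∈-bit u u∈S) (∈-bit v v∈S)) refl refl)

  disconnected : 2 ≤ cyclicEnds n S → connectedB Γ S ≡ false
  disconnected two = false-¬T (λ c → separated (count-≥2-witness n End two) (true-T c))
    where
    -- A walk from the right end b back to the right end a would leave the arc cut off by them.
    separated : (Σ ℕ λ a → Σ ℕ λ b → a < b × b < n × T (End a) × T (End b)) →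
      connectedB Γ S ≡ true → ⊥
    separated (a , b , a<b , b<n , ea , eb) c =
      a-outside (subst Inside (toℕ-fromℕ< a<n) (walk-closed (λ v → Inside (toℕ v)) step n
        (vertex b b<n) (vertex a a<n)
        (connected-elim c (vertex b b<n) (vertex a a<n) (∈-vertex b b<n (End⇒∈ b eb)) (∈-vertex a a<n (End⇒∈ a ea)))
        (subst Inside (sym (toℕ-fromℕ< b<n)) b-inside)))
      where
      open Separation a b a<b b<n ea eb
      a<n : a < n
      a<n = <-trans a<b b<n
      step : ∀ x y → Inside (toℕ x) → T (adj Γ x y) → T (inB y S) → Inside (toℕ y)
      step x y ix x~y y∈S = step-inside (toℕ x) (toℕ y) (toℕ<n y) ix x~y (∈-bit y y∈S)

  exponent≡ : ℕ → Bool
  exponent≡ e = ⌊ (ℤ.+ n) ℤ.+ kS Γ S ℤ.≟ ℤ.+ e ⌋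

  term : ℕ → Bool
  term e = nonemptyB S ∧ connectedB Γ S ∧ exponent≡ e

  term-≡ : ∀ e k a → nonemptyB S ≡ true → connectedB Γ S ≡ true → kS Γ S ≡ k →
    ℤ.+ n ℤ.+ k ≡ ℤ.+ a → term e ≡ ⌊ e ≟ a ⌋
  term-≡ e k a ne c kS≡k n+k≡a =
    trans (cong₂ _∧_ ne (cong₂ _∧_ c (cong (λ z → ⌊ ℤ.+ n ℤ.+ z ℤ.≟ ℤ.+ e ⌋) kS≡k)))
          (trans (cong (λ z → ⌊ z ℤ.≟ ℤ.+ e ⌋) n+k≡a) (⌊+≟+⌋ a e))

  term-empty : size S ≡ 0 → ∀ e → term e ≡ false
  term-empty size≡0 e = cong (_∧ (connectedB Γ S ∧ exponent≡ e)) (nonempty-false empty)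
    where
    empty : ∀ v → ¬ T (inB v S)
    empty v v∈S with subst (1 ≤_) (trans (sym (size-count S)) size≡0)
                            (count-≥1 n (bit S) (toℕ v) (toℕ<n v) (∈-bit v v∈S))
    ... | ()

  term-disconnected : 2 ≤ cyclicEnds n S → ∀ e → term e ≡ false
  term-disconnected two e =
    trans (cong (λ c → nonemptyB S ∧ c ∧ exponent≡ e) (disconnected two)) (∧-zeroʳ (nonemptyB S))

  -- A singleton: its vertex has no neighbour in S, so k_S = -2 and the exponent is n - 2.
  term-singleton : size S ≡ 1 → AtMostOneEnd → ∀ e → term e ≡ ⌊ e ≟ n ∸ 2 ⌋
  term-singleton size≡1 le e =
    from-witness (count-≥1-witness n (bit S) (subst (1 ≤_) (trans (sym size≡1) (size-count S)) ≤-refl))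
    where
    n-2 : ∀ a → 2 ≤ a → ℤ.+ a ℤ.+ -[1+ 1 ] ≡ ℤ.+ (a ∸ 2)
    n-2 (suc (suc _)) _          = refl
    n-2 (suc zero)    (s≤s ())
    at-most-one : ∀ i j → i < j → j < n → T (bit S i) → T (bit S j) → ⊥
    at-most-one i j i<j j<n si sj with subst (2 ≤_) (trans (sym (size-count S)) size≡1) (count-≥2 n (bit S) i j i<j j<n si sj)
    ... | s≤s ()
    isolated : ∀ v → T (inB v S) → δ Γ S v ≡ 0
    isolated v v∈S = trans (δ-count S v) (count-zero n (NeighbourIn S v) no-neighbour)
      where
      no-neighbour : ∀ j → j < n → ¬ T (NeighbourIn S v j)
      no-neighbour j j<n t with <-cmp j (toℕ v) | to T-∧ t
      ... | tri< j<v _ _ | _ , j∈S = at-most-one j (toℕ v) j<v (toℕ<n v) j∈S (∈-bit v v∈S)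
      ... | tri≈ _ refl _ | v~v , _ = adjacent-irrefl n j n≥2 v~v
      ... | tri> _ _ v<j | _ , j∈S = at-most-one (toℕ v) j v<j j<n (∈-bit v v∈S) j∈S
    from-witness : (Σ ℕ λ j → j < n × T (bit S j)) → term e ≡ ⌊ e ≟ n ∸ 2 ⌋
    from-witness (j , j<n , j∈S) =
      term-≡ e -[1+ 1 ] (n ∸ 2) (nonempty-intro v₀ v₀∈S) (connected le) (kS-isolated S isolated v₀ v₀∈S) (n-2 n n≥2)
      where
      v₀ = vertex j j<n
      v₀∈S = ∈-vertex j j<n j∈S

  -- In a connected S with at least two vertices every vertex has a neighbour in
  -- S: the first step of a walk to another vertex of S.
  linked : 2 ≤ size S → AtMostOneEnd → ∀ v → T (inB v S) → 1 ≤ δ Γ S v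
  linked size≥2 le v v∈S = subst (1 ≤_) (sym (δ-count S v))
    (two-members (count-≥2-witness n (bit S) (subst (2 ≤_) (size-count S) size≥2)))
    where
    neighbour-toward : ∀ w → w < n → T (bit S w) → toℕ v ≢ w → 1 ≤ count n (NeighbourIn S v)
    neighbour-toward w w<n w∈S v≢w =
      first-neighbour (first-step (joined le (toℕ v) w (toℕ<n v) w<n (∈-bit v v∈S) w∈S) v≢w)
      where
      first-neighbour : (Σ ℕ λ j → Adj n (toℕ v) j × T (bit S j) × j < n) → 1 ≤ count n (NeighbourIn S v)
      first-neighbour (j , v~j , j∈S , j<n) = count-≥1 n (NeighbourIn S v) j j<n (from T-∧ (v~j , j∈S))
    two-members : (Σ ℕ λ a → Σ ℕ λ b → a < b × b < n × T (bit S a) × T (bit S b)) →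
      1 ≤ count n (NeighbourIn S v)
    two-members (a , b , a<b , b<n , a∈S , b∈S) with toℕ v ≟ a
    ... | yes refl = neighbour-toward b b<n b∈S (<⇒≢ a<b)
    ... | no  v≢a  = neighbour-toward a (<-trans a<b b<n) a∈S v≢a

  -- A proper arc with at least two vertices: every vertex has a neighbour in S
  -- and a right end has exactly one, so k_S = 0 and the exponent is n.
  term-arc : 2 ≤ size S → cyclicEnds n S ≡ 1 → ∀ e → term e ≡ ⌊ e ≟ n ⌋
  term-arc size≥2 one-end e = from-end (count-≥1-witness n End (subst (1 ≤_) (sym one-end) ≤-refl))
    where
    le : AtMostOneEnd
    le = subst (_≤ 1) (sym one-end) ≤-refl
    from-end : (Σ ℕ λ i → i < n × T (End i)) → term e ≡ ⌊ e ≟ n ⌋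
    from-end (i , i<n , eᵢ) =
      term-≡ e (ℤ.+ 0) n (nonempty-intro v₀ v₀∈S) (connected le) (kS-leaf S (linked size≥2 le) v₀ v₀∈S leaf)
             (cong ℤ.+_ (+-identityʳ n))
      where
      v₀ = vertex i i<n
      v₀∈S = ∈-vertex i i<n (End⇒∈ i eᵢ)
      -- The successor of the right end i lies outside S.
      outside-neighbour : 1 ≤ δ Γ (∁ S) v₀
      outside-neighbour = subst (1 ≤_) (sym (δ-count (∁ S) v₀))
        (count-≥1 n (NeighbourIn (∁ S) v₀) (next n i) (next< n i i<n)
          (from T-∧ ( subst (λ z → T (cycleAdjℕ n z (next n i))) (sym (toℕ-fromℕ< i<n)) (adjacent-next n i i<n)
                    , subst T (sym (bit-∁ S (next n i) (next< n i i<n))) (not-¬T (End⇒next∉ i eᵢ)))))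
      leaf : δ Γ S v₀ ≡ 1
      leaf = both-one (δ-split S v₀) (linked size≥2 le v₀ v₀∈S) outside-neighbour

  -- The whole cycle: every vertex has both neighbours in S, so k_S = 2 and the exponent is n + 2.
  term-whole : size S ≡ n → AtMostOneEnd → ∀ e → term e ≡ ⌊ e ≟ n + 2 ⌋
  term-whole size≡n le e =
    term-≡ e (ℤ.+ 2) (n + 2) (nonempty-intro v₀ (∈-vertex 0 (s≤s z≤n) (all∈S 0 (s≤s z≤n)))) (connected le) (kS-full S full) refl
    where
    v₀ = vertex 0 (s≤s z≤n)
    all∈S : ∀ j → j < n → T (bit S j)
    all∈S j j<n with T? (bit S j)
    ... | yes j∈S = j∈S
    ... | no  j∉S = ⊥-elim (<-irrefl (trans (sym (size-count S)) size≡n) (count-< n (bit S) j j<n j∉S))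
    full : ∀ v → δ Γ S v ≡ 2
    full v = trans (δ-count S v)
      (trans (count-ext n {NeighbourIn S v} {cycleAdjℕ n (toℕ v)}
                        (λ j j<n → trans (cong (cycleAdjℕ n (toℕ v) j ∧_) (true-T (all∈S j j<n)))
                                         (∧-identityʳ _)))
             (degree-two n (toℕ v) n≥3 (toℕ<n v)))

  ends-from : ∀ r l h → linearEnds S ≡ r → last S ≡ l → head S ≡ h → cyclicEnds n S ≡ r + [ l ∧ not h ]ᵇ
  ends-from r l h er el eh = trans (cyclicEnds-linear m S) (cong₂ _+_ er (cong [_]ᵇ (cong₂ (λ x y → x ∧ not y) el eh)))

  private
    ≤1 : ∀ {x} → x ≡ 1 → x ≤ 1
    ≤1 refl = ≤-refl
    ≤0 : ∀ {x} → x ≡ 0 → x ≤ 1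
    ≤0 refl = z≤n

  term-by-state : ∀ e q → Invariant q n (size S) (linearEnds S) (head S) (last S) →
    term e ≡ verdict ⌊ e ≟ n ∸ 2 ⌋ ⌊ e ≟ n ⌋ ⌊ e ≟ n + 2 ⌋ q
  term-by-state e E    ()
  term-by-state e Z    (z≡0 , _) = term-empty z≡0 e
  term-by-state e O1   (refl , _) = ⊥-elim (<⇒≱ (s≤s (s≤s z≤n)) n≥3)
  term-by-state e O    (z≡n , _ , r , h , l) = term-whole z≡n (≤0 (ends-from 0 true true r l h)) e
  term-by-state e ZO1  (z≡1 , _ , r , h , l) = term-singleton z≡1 (≤1 (ends-from 0 true false r l h)) e
  term-by-state e ZO   (z≥2 , _ , r , h , l) = term-arc z≥2 (ends-from 0 true false r l h) e
  term-by-state e OZ1  (z≡1 , _ , r , h , l) = term-singleton z≡1 (≤1 (ends-from 1 false true r l h)) e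
  term-by-state e OZ   (z≥2 , _ , r , h , l) = term-arc z≥2 (ends-from 1 false true r l h) e
  term-by-state e ZOZ1 (z≡1 , _ , r , h , l) = term-singleton z≡1 (≤1 (ends-from 1 false false r l h)) e
  term-by-state e ZOZ  (z≥2 , _ , r , h , l) = term-arc z≥2 (ends-from 1 false false r l h) e
  term-by-state e OZO  (z≥2 , _ , r , h , l) = term-arc z≥2 (ends-from 1 true true r l h) e
  term-by-state e X    two = term-disconnected (subst (2 ≤_) (sym (cyclicEnds-linear m S)) two) e

  term-verdict : ∀ e → term e ≡ verdict ⌊ e ≟ n ∸ 2 ⌋ ⌊ e ≟ n ⌋ ⌊ e ≟ n + 2 ⌋ (run S E)
  term-verdict e = term-by-state e (run S E) (invariant S)

count-verdict : ∀ n → 3 ≤ n → (single arc whole : Bool) →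
  (T single → T arc → ⊥) → (T single → T whole → ⊥) → (T arc → T whole → ⊥) →
  #subsets n (λ S → verdict single arc whole (run S E))
    ≡ (if single then n else 0) + (if arc then n * (n ∸ 2) else 0) + (if whole then 1 else 0)
count-verdict n _ true  true  _     ¬sa _   _   = ⊥-elim (¬sa tt tt)
count-verdict n _ true  false true  _   ¬sw _   = ⊥-elim (¬sw tt tt)
count-verdict n _ false true  true  _   _   ¬aw = ⊥-elim (¬aw tt tt)
count-verdict n _ true  false false _ _ _ = trans (count-singles n) (sym (trans (+-identityʳ _) (+-identityʳ n)))
count-verdict n _ false true  false _ _ _ = trans (count-arcs n) (sym (+-identityʳ _))
count-verdict (suc (suc (suc k))) _ false false true _ _ _ = count-wholes (suc (suc (suc k)))
count-verdict (suc zero)       (s≤s ())       false false true _ _ _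
count-verdict (suc (suc zero)) (s≤s (s≤s ())) false false true _ _ _
count-verdict n _ false false false _ _ _ = count-rejected n

proposition3p4 : (n : ℕ) → 3 ≤ n → (m : ℕ) →
    alliancePoly (cycleGraph n) m
      ≡ (mono n (n ∸ 2) +ₚ mono (n * (n ∸ 2)) n +ₚ mono 1 (n + 2)) m
proposition3p4 zero () _
proposition3p4 (suc k) n≥3 e =
  begin
    alliancePoly (cycleGraph n) e
  ≡⟨ #subsets-ext n (λ S → Classify.term-verdict k n≥3 S e) ⟩
    #subsets n (λ S → verdict ⌊ e ≟ n ∸ 2 ⌋ ⌊ e ≟ n ⌋ ⌊ e ≟ n + 2 ⌋ (run S E))
  ≡⟨ count-verdict n n≥3 ⌊ e ≟ n ∸ 2 ⌋ ⌊ e ≟ n ⌋ ⌊ e ≟ n + 2 ⌋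
                   (distinct n-2<n) (distinct (≤-trans n-2<n (m≤m+n n 2))) (distinct (m<m+n n (s≤s z≤n))) ⟩
    (mono n (n ∸ 2) +ₚ mono (n * (n ∸ 2)) n +ₚ mono 1 (n + 2)) e
  ∎
  where
  open ≡-Reasoning
  n = suc k
  distinct : ∀ {a b} → a < b → T ⌊ e ≟ a ⌋ → T ⌊ e ≟ b ⌋ → ⊥
  distinct a<b ea eb = <-irrefl (trans (sym (T-≟ ea)) (T-≟ eb)) a<b
  n-2<n : n ∸ 2 < n
  n-2<n = s≤s (m∸n≤m k 1)
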